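{- Let $b\ge 2$ be even. Then there exist infinitely many $b$-ARH numbers that are not $b$-MRH numbers.
   Context: For a positive integer $N$, $s_b(N)$ is the sum of the base-$b$ digits of $N$, and the reversal $N^R$ is the integer obtained by writing the base-$b$ digits of $N$ in reverse order. A positive integer $N$ is a $b$-ARH number if there exists a positive integer $M$ such that $N=Ms_b(N)+(Ms_b(N))^R$. A positive integer $N$ is a $b$-MRH number if there exists a positive integer $M$ such that $N=Ms_b(N)\cdot(Ms_b(N))^R$. -}

module Defs where

open import Data.Nat using (ℕ; zero; suc; _+_; _*_; _≤_; _<_; NonZero)
open import Data.Nat.DivMod using (_/_; _%_)
open import Data.List using (List; []; _∷_; foldl)
open import Data.Nat.ListAction using (sum)
open import Data.Product using (∃; _×_)
open import Relation.Binary.PropositionalEquality using (_≡_)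
open import Relation.Nullary using (¬_)

-- Base-b digits of n, least significant digit first, with a fuel argument.
-- digits-fuel with fuel ≥ n yields the full expansion (each step divides by b ≥ 2).
-- 0 has the empty digit list.
digitsAux : (b : ℕ) → .{{_ : NonZero b}} → (fuel n : ℕ) → List ℕ
digitsAux b zero    n       = []
digitsAux b (suc f) zero    = []
digitsAux b (suc f) (suc n) = (suc n % b) ∷ digitsAux b f (suc n / b)

digits : (b : ℕ) → .{{_ : NonZero b}} → ℕ → List ℕ
digits b n = digitsAux b n n

digitSum : (b : ℕ) → .{{_ : NonZero b}} → ℕ → ℕ
digitSum b n = sum (digits b n)

-- the reversal n^R: the base-b digits of n read in reverse order.
-- With digits d₀ d₁ … d_k (least significant first), n^R = Σ d_i b^{k-i},
-- computed by Horner's scheme from d₀.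
reversal : (b : ℕ) → .{{_ : NonZero b}} → ℕ → ℕ
reversal b n = foldl (λ acc d → acc * b + d) 0 (digits b n)

IsARH : (b : ℕ) → .{{_ : NonZero b}} → ℕ → Set
IsARH b N = 0 < N × ∃ λ M → 0 < M × N ≡ M * digitSum b N + reversal b (M * digitSum b N)

IsMRH : (b : ℕ) → .{{_ : NonZero b}} → ℕ → Set
IsMRH b N = 0 < N × ∃ λ M → 0 < M × N ≡ M * digitSum b N * reversal b (M * digitSum b N)

module Submission where

-- For even b = 2c and k ≥ 0 put
--     N = b^(k+1) + 1,     M = c · b^k.
-- In base b, N has digits 1 0 … 0 1, so s_b(N) = 2, hence M · s_b(N) = b^(k+1),
-- whose reversal is 1; therefore N = M s_b(N) + (M s_b(N))^R and N is b-ARH.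
-- On the other hand N is odd, whereas a b-MRH number whose digit sum is even
-- is itself even (it is a multiple of its digit sum), so N is not b-MRH.
-- Since N > k, letting k grow gives infinitely many such N.

open import Defs
open import Data.Nat using (ℕ; _≤_; _*_; NonZero)
open import Data.Product using (∃; _×_)
open import Relation.Nullary using (¬_)
open import Relation.Binary.PropositionalEquality using (_≡_)

open import Data.Nat using (zero; suc; _+_; _^_; _<_; _/_; _%_; z≤n; s≤s; >-nonZero; >-nonZero⁻¹)
open import Data.Nat.Properties
open import Data.Nat.DivMod using (m<n⇒m%n≡m; [m+kn]%n≡m%n; m*n%n≡0; +-distrib-/; m<n⇒m/n≡0; m*n/n≡m)
open import Data.List using ([]; _∷_; foldl; replicate; _++_)
open import Data.Nat.ListAction using (sum)
open import Data.Product using (_,_)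
open import Data.Empty using (⊥-elim)
open import Relation.Binary.PropositionalEquality using (refl; sym; trans; cong; cong₂; subst; module ≡-Reasoning)

module Expansions (b : ℕ) .{{_ : NonZero b}} (1<b : 1 < b) where

  digit-%  : ∀ r q → r < b → (r + q * b) % b ≡ r
  digit-%  r q r<b = trans ([m+kn]%n≡m%n r q b) (m<n⇒m%n≡m r<b)

  digit-/ : ∀ r q → r < b → (r + q * b) / b ≡ q
  digit-/ r q r<b = begin
      (r + q * b) / b         ≡⟨ +-distrib-/ r (q * b) remainders<b ⟩
      r / b + q * b / b       ≡⟨ cong₂ _+_ (m<n⇒m/n≡0 r<b) (m*n/n≡m q b) ⟩
      q                       ∎
    where
      open ≡-Reasoning
      remainders<b : r % b + (q * b) % b < b
      remainders<b = subst (_< b) (sym (trans (cong₂ _+_ (m<n⇒m%n≡m r<b) (m*n%n≡0 q b)) (+-identityʳ r))) r<b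

  digits-step : ∀ f r q → r < b → 0 < r + q * b →
                digitsAux b (suc f) (r + q * b) ≡ r ∷ digitsAux b f q
  digits-step f r q r<b pos with r + q * b | digit-% r q r<b | digit-/ r q r<b
  ... | suc n | n%b≡r | n/b≡q = cong₂ _∷_ n%b≡r (cong (digitsAux b f) n/b≡q)

  -- b^(k+1) = 0 + b^k·b, the shape consumed by 'digits-step'.
  pow-split : ∀ k → b ^ suc k ≡ 0 + b ^ k * b
  pow-split k = *-comm b (b ^ k)

  b^k>0 : ∀ k → 0 < b ^ k
  b^k>0 k = m^n>0 b k

  -- b^k < b^(k+1): the fuel drops by one per digit but stays adequate.
  b^k<b^[1+k] : ∀ k → b ^ k < b ^ suc k
  b^k<b^[1+k] k = ^-monoʳ-< b 1<b (n<1+n k)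

  digits-pow : ∀ k f → b ^ k ≤ f → digitsAux b f (b ^ k) ≡ replicate k 0 ++ 1 ∷ []
  digits-pow zero (suc f) _ = begin
      digitsAux b (suc f) (1 + 0 * b)   ≡⟨ digits-step f 1 0 1<b (s≤s z≤n) ⟩
      1 ∷ digitsAux b f 0               ≡⟨ cong (1 ∷_) (digitsAux-zero f) ⟩
      1 ∷ []                            ∎
    where
      open ≡-Reasoning
      digitsAux-zero : ∀ f → digitsAux b f 0 ≡ []
      digitsAux-zero zero    = refl
      digitsAux-zero (suc _) = refl
  digits-pow (suc k) zero le = ⊥-elim (≤⇒≯ le (b^k>0 (suc k)))
  digits-pow (suc k) (suc f) le = begin
      digitsAux b (suc f) (b ^ suc k)      ≡⟨ cong (digitsAux b (suc f)) (pow-split k) ⟩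
      digitsAux b (suc f) (0 + b ^ k * b)  ≡⟨ digits-step f 0 (b ^ k) (<-trans (s≤s z≤n) 1<b) pos ⟩
      0 ∷ digitsAux b f (b ^ k)            ≡⟨ cong (0 ∷_) (digits-pow k f fuel) ⟩
      0 ∷ replicate k 0 ++ 1 ∷ []          ∎
    where
      open ≡-Reasoning
      pos : 0 < 0 + b ^ k * b
      pos = subst (0 <_) (pow-split k) (b^k>0 (suc k))
      fuel : b ^ k ≤ f
      fuel = ≤-pred (≤-trans (b^k<b^[1+k] k) le)

  digits-1+pow : ∀ k f → 1 + b ^ suc k ≤ f →
                 digitsAux b f (1 + b ^ suc k) ≡ 1 ∷ replicate k 0 ++ 1 ∷ []
  digits-1+pow k (suc f) le = begin
      digitsAux b (suc f) (1 + b ^ suc k)  ≡⟨ cong (λ x → digitsAux b (suc f) (1 + x)) (*-comm b (b ^ k)) ⟩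
      digitsAux b (suc f) (1 + b ^ k * b)  ≡⟨ digits-step f 1 (b ^ k) 1<b (s≤s z≤n) ⟩
      1 ∷ digitsAux b f (b ^ k)            ≡⟨ cong (1 ∷_) (digits-pow k f fuel) ⟩
      1 ∷ replicate k 0 ++ 1 ∷ []          ∎
    where
      open ≡-Reasoning
      fuel : b ^ k ≤ f
      fuel = ≤-trans (<⇒≤ (b^k<b^[1+k] k)) (≤-pred le)

  digitSum-1+pow : ∀ k → digitSum b (1 + b ^ suc k) ≡ 2
  digitSum-1+pow k =
    trans (cong sum (digits-1+pow k (1 + b ^ suc k) ≤-refl)) (cong suc (sum-zeros-one k))
    where
      sum-zeros-one : ∀ k → sum (replicate k 0 ++ 1 ∷ []) ≡ 1
      sum-zeros-one zero    = refl
      sum-zeros-one (suc k) = sum-zeros-one k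

  -- (b^k)^R = 1: reading 0 … 0 1 by Horner's scheme, the zeros contribute nothing.
  reversal-pow : ∀ k → reversal b (b ^ k) ≡ 1
  reversal-pow k = trans (cong (foldl horner 0) (digits-pow k (b ^ k) ≤-refl)) (horner-zeros-one k)
    where
      horner : ℕ → ℕ → ℕ
      horner acc d = acc * b + d
      horner-zeros-one : ∀ k → foldl horner 0 (replicate k 0 ++ 1 ∷ []) ≡ 1
      horner-zeros-one zero    = refl
      horner-zeros-one (suc k) = horner-zeros-one k

MRH-multiple : ∀ b .{{_ : NonZero b}} N → IsMRH b N → ∃ λ h → N ≡ digitSum b N * h
MRH-multiple b N (_ , M , _ , N≡product) = M * R , (begin
    N                  ≡⟨ N≡product ⟩
    M * s * R          ≡⟨ cong (_* R) (*-comm M s) ⟩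
    s * M * R          ≡⟨ *-assoc s M R ⟩
    s * (M * R)        ∎)
  where
    open ≡-Reasoning
    s R : ℕ
    s = digitSum b N
    R = reversal b (M * s)

n<b^n : ∀ b → 1 < b → ∀ n → n < b ^ n
n<b^n b 1<b zero    = s≤s z≤n
n<b^n b 1<b (suc n) = begin-strict
    suc n              ≤⟨ n<b^n b 1<b n ⟩
    b ^ n              <⟨ ^-monoʳ-< b 1<b (n<1+n n) ⟩
    b ^ suc n          ∎
  where open ≤-Reasoning

module EvenBase (b : ℕ) .{{_ : NonZero b}} (1<b : 1 < b) (c : ℕ) (b≡2c : b ≡ 2 * c) where

  open Expansions b 1<b

  b^[1+k]≡2M : ∀ k → b ^ suc k ≡ 2 * (c * b ^ k)
  b^[1+k]≡2M k = trans (cong (_* b ^ k) b≡2c) (*-assoc 2 c (b ^ k))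

  multiplier>0 : ∀ k → 0 < c * b ^ k
  multiplier>0 k = >-nonZero⁻¹ (c * b ^ k) {{m*n≢0⇒n≢0 2 {{>-nonZero 2M>0}}}}
    where
      2M>0 : 0 < 2 * (c * b ^ k)
      2M>0 = subst (0 <_) (b^[1+k]≡2M k) (b^k>0 (suc k))

  -- b^(k+1) + 1 is b-ARH, witnessed by M = c b^k: M · s_b(N) = b^(k+1) has reversal 1.
  pow+1-ARH : ∀ k → IsARH b (1 + b ^ suc k)
  pow+1-ARH k = s≤s z≤n , M , multiplier>0 k , (begin
      1 + b ^ suc k                      ≡⟨ +-comm 1 (b ^ suc k) ⟩
      b ^ suc k + 1                      ≡⟨ cong (b ^ suc k +_) (sym (reversal-pow (suc k))) ⟩
      b ^ suc k + reversal b (b ^ suc k) ≡⟨ cong (λ x → x + reversal b x) (sym M·s≡b^[1+k]) ⟩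
      M * s + reversal b (M * s)         ∎)
    where
      open ≡-Reasoning
      M s : ℕ
      M = c * b ^ k
      s = digitSum b (1 + b ^ suc k)
      M·s≡b^[1+k] : M * s ≡ b ^ suc k
      M·s≡b^[1+k] = trans (cong (M *_) (digitSum-1+pow k)) (trans (*-comm M 2) (sym (b^[1+k]≡2M k)))

  -- b^(k+1) + 1 is odd with digit sum 2, so it is not b-MRH.
  pow+1-not-MRH : ∀ k → ¬ IsMRH b (1 + b ^ suc k)
  pow+1-not-MRH k mrh with h , N≡sh ← MRH-multiple b (1 + b ^ suc k) mrh =
    even≢odd h (c * b ^ k) (begin
      2 * h                                 ≡⟨ cong (_* h) (digitSum-1+pow k) ⟨
      digitSum b (1 + b ^ suc k) * h        ≡⟨ N≡sh ⟨
      1 + b ^ suc k                         ≡⟨ cong suc (b^[1+k]≡2M k) ⟩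
      1 + 2 * (c * b ^ k)                   ∎)
    where open ≡-Reasoning

corollary19 : (b : ℕ) → .{{_ : NonZero b}} → 2 ≤ b → (∃ λ k → b ≡ 2 * k) →
              (n : ℕ) → ∃ λ N → n ≤ N × IsARH b N × ¬ IsMRH b N
corollary19 b 1<b (c , b≡2c) n = 1 + b ^ suc n , n≤N , pow+1-ARH n , pow+1-not-MRH n
  where
    open EvenBase b 1<b c b≡2c
    n≤N : n ≤ 1 + b ^ suc n
    n≤N = begin
      n            ≤⟨ n≤1+n n ⟩
      suc n        ≤⟨ <⇒≤ (n<b^n b 1<b (suc n)) ⟩
      b ^ suc n    ≤⟨ n≤1+n _ ⟩
      1 + b ^ suc n  ∎
      where open ≤-Reasoning
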